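{- Let $G=(V,E)$ be a finite simple undirected graph, let $k\ge 0$ be an integer and let $lb$ be an integer. If $\theta(G,k)\ge lb$ and there is a vertex $u\in V$ such that $\omega(G[N(u)])\le lb-2$, then $\theta(G,k)=\theta(G[V\setminus\{u\}],k)$.
   Context: For a vertex $u$, $N(u)=\{w : \{u,w\}\in E\}$ is its open neighborhood. For $S\subseteq V$, $G[S]$ is the subgraph induced by $S$. $\omega(H)$ denotes the size of a largest clique in a graph $H$. For a graph $G=(V,E)$ and a nonnegative integer $k$, $\theta(G,k)=\min_{S\subseteq V,\ |S|\le k}\omega(G[V\setminus S])$ (the minimum possible size of the largest clique after deleting at most $k$ vertices). -}

module Defs where

open import Data.Nat using (ℕ; _≤_)
open import Data.Fin using (Fin)
open import Data.Fin.Subset using (Subset; _∈_; _∉_; _⊆_; _─_; _-_; ∣_∣; ⊤; ⊥)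
open import Data.Product using (Σ; _×_; ∃)
open import Relation.Binary.PropositionalEquality using (_≡_)
open import Relation.Nullary using (¬_)

record Graph (n : ℕ) : Set₁ where
  field
    Adj     : Fin n → Fin n → Set
    adj?    : ∀ u v → Relation.Nullary.Dec (Adj u v)
    irrefl  : ∀ u → ¬ Adj u u
    sym     : ∀ {u v} → Adj u v → Adj v u
open Graph public

module _ {n : ℕ} (G : Graph n) where

  N : Fin n → Subset n → Set
  N u W = ∀ w → (w ∈ W → Adj G u w) × (Adj G u w → w ∈ W)

  IsClique : Subset n → Set
  IsClique C = ∀ v w → v ∈ C → w ∈ C → ¬ (v ≡ w) → Adj G v w

  IsCliqueNumber : Subset n → ℕ → Set
  IsCliqueNumber W c =
    (Σ (Subset n) λ C → C ⊆ W × IsClique C × ∣ C ∣ ≡ c)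
    × (∀ C → C ⊆ W → IsClique C → ∣ C ∣ ≤ c)

  -- θ(G[W], k) = t : minimum, over S ⊆ W with |S| ≤ k, of ω(G[W ∖ S])
  IsTheta : Subset n → ℕ → ℕ → Set
  IsTheta W k t =
    (Σ (Subset n) λ S → S ⊆ W × ∣ S ∣ ≤ k × IsCliqueNumber (W ─ S) t)
    × (∀ S c → S ⊆ W → ∣ S ∣ ≤ k → IsCliqueNumber (W ─ S) c → t ≤ c)

-- Every deletion set for G − u is one for G, so θ(G,k) ≤ θ(G − u,k) unless a largest clique
-- left in G by such a deletion contains u; that clique lies in {u} ∪ N(u), so it has at most
-- ω(G[N(u)]) + 1 ≤ lb − 1 < θ(G,k) vertices, which is absurd. Conversely, intersecting an
-- optimal deletion set of G with V ∖ {u} gives θ(G − u,k) ≤ θ(G,k).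
module Submission where

open import Defs
open import Data.Nat using (ℕ)
open import Data.Integer using (ℤ; +_; _≤_) renaming (_-_ to _-ℤ_)
open import Data.Fin using (Fin)
open import Data.Fin.Subset using (Subset; ⊤) renaming (_-_ to _∖_)
open import Relation.Binary.PropositionalEquality using (_≡_)

open import Data.Integer using (-_) renaming (_+_ to _+ℤ_)
import Data.Nat as ℕ
import Data.Nat.Properties as ℕₚ
import Data.Integer.Properties as ℤₚ
import Data.Fin.Properties as Finₚ
open import Data.Fin.Subset using (_∈_; _∉_; _⊆_; _─_; _∩_; ∣_∣; ⁅_⁆; ⊥; inside; outside)
open import Data.Fin.Subset.Properties
open import Data.Vec using (_∷_; []; here; there)
open import Data.Product using (∃; _×_; _,_)
open import Data.Sum using (_⊎_; inj₁; inj₂; [_,_]′; map)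
open import Function using (id)
open import Relation.Nullary using (Dec; yes; no; ¬?; contradiction)
open import Relation.Nullary.Decidable using (_×-dec_; _→-dec_)
open import Relation.Unary using (Pred; Decidable)
open import Relation.Binary.PropositionalEquality using (refl; cong; subst; _≢_; module ≡-Reasoning) renaming (sym to ≡-sym)

∣p∣≤∣p─q∣+∣q∣ : ∀ {n} (p q : Subset n) → ∣ p ∣ ℕ.≤ ∣ p ─ q ∣ ℕ.+ ∣ q ∣
∣p∣≤∣p─q∣+∣q∣ []            []            = ℕ.z≤n
∣p∣≤∣p─q∣+∣q∣ (inside ∷ p)  (inside ∷ q)  =
  subst (ℕ.suc ∣ p ∣ ℕ.≤_) (≡-sym (ℕₚ.+-suc ∣ p ─ q ∣ ∣ q ∣)) (ℕ.s≤s (∣p∣≤∣p─q∣+∣q∣ p q))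
∣p∣≤∣p─q∣+∣q∣ (inside ∷ p)  (outside ∷ q) = ℕ.s≤s (∣p∣≤∣p─q∣+∣q∣ p q)
∣p∣≤∣p─q∣+∣q∣ (outside ∷ p) (inside ∷ q)  =
  ℕₚ.≤-trans (∣p∣≤∣p─q∣+∣q∣ p q) (ℕₚ.+-monoʳ-≤ ∣ p ─ q ∣ (ℕₚ.n≤1+n ∣ q ∣))
∣p∣≤∣p─q∣+∣q∣ (outside ∷ p) (outside ∷ q) = ∣p∣≤∣p─q∣+∣q∣ p q

∣p∣≤1+∣p-x∣ : ∀ {n} (p : Subset n) x → ∣ p ∣ ℕ.≤ ℕ.suc ∣ p ∖ x ∣
∣p∣≤1+∣p-x∣ p x = subst (∣ p ∣ ℕ.≤_) eq (∣p∣≤∣p─q∣+∣q∣ p ⁅ x ⁆)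
  where
  open ≡-Reasoning
  eq : ∣ p ∖ x ∣ ℕ.+ ∣ ⁅ x ⁆ ∣ ≡ ℕ.suc ∣ p ∖ x ∣
  eq = begin
    ∣ p ∖ x ∣ ℕ.+ ∣ ⁅ x ⁆ ∣ ≡⟨ cong (∣ p ∖ x ∣ ℕ.+_) (∣⁅x⁆∣≡1 x) ⟩
    ∣ p ∖ x ∣ ℕ.+ 1         ≡⟨ ℕₚ.+-comm ∣ p ∖ x ∣ 1 ⟩
    ℕ.suc ∣ p ∖ x ∣         ∎

x∈p─q⇒x∉q : ∀ {n} {x : Fin n} (p q : Subset n) → x ∈ p ─ q → x ∉ q
x∈p─q⇒x∉q (_ ∷ p)      (inside ∷ q)  (there x∈) (there x∈q) = x∈p─q⇒x∉q p q x∈ x∈q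
x∈p─q⇒x∉q (_ ∷ p)      (outside ∷ q) (there x∈) (there x∈q) = x∈p─q⇒x∉q p q x∈ x∈q
x∈p─q⇒x∉q (inside ∷ p) (outside ∷ q) here       ()

x∈p-y⇒x≢y : ∀ {n} {x y : Fin n} (p : Subset n) → x ∈ p ∖ y → x ≢ y
x∈p-y⇒x≢y {y = y} p x∈ refl = x∈p─q⇒x∉q p ⁅ y ⁆ x∈ (x∈⁅x⁆ y)

p─p∩q⊆r─q : ∀ {n} {p q r : Subset n} → p ⊆ r → p ─ (p ∩ q) ⊆ r ─ q
p─p∩q⊆r─q {p = p} {q} p⊆r {x} x∈ = x∈p∧x∉q⇒x∈p─q (p⊆r x∈p)
  (λ x∈q → x∈p─q⇒x∉q p (p ∩ q) x∈ (x∈p∩q⁺ (x∈p , x∈q)))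
  where
  x∈p : x ∈ p
  x∈p = p─q⊆p p (p ∩ q) x∈

greatest-≤ : ∀ {ℓ} {P : Pred ℕ ℓ} → Decidable P → P 0 → ∀ m →
             ∃ λ c → P c × (∀ {d} → d ℕ.≤ m → P d → d ℕ.≤ c)
greatest-≤ P? p0 ℕ.zero = 0 , p0 , λ { ℕ.z≤n _ → ℕ.z≤n }
greatest-≤ {P = P} P? p0 (ℕ.suc m) with P? (ℕ.suc m)
... | yes pm = ℕ.suc m , pm , λ d≤ _ → d≤
... | no ¬pm with greatest-≤ P? p0 m
...   | c , pc , below = c , pc , below′
  where
  below′ : ∀ {d} → d ℕ.≤ ℕ.suc m → P d → d ℕ.≤ c
  below′ d≤ pd with ℕₚ.m≤n⇒m<n∨m≡n d≤
  ... | inj₁ d<1+m = below (ℕₚ.≤-pred d<1+m) pd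
  ... | inj₂ refl  = contradiction pd ¬pm

1+ω<t : ∀ {lb : ℤ} {ω t : ℕ} → + ω ≤ lb -ℤ + 2 → lb ≤ + t → ℕ.suc ω ℕ.< t
1+ω<t {lb} {ω} {t} ω≤lb-2 lb≤t =
  subst (ℕ._≤ t) (ℕₚ.+-comm ω 2) (ℤₚ.drop‿+≤+ (ℤₚ.≤-trans ω+2≤lb lb≤t))
  where
  open ≡-Reasoning
  lb-2+2≡lb : (lb -ℤ + 2) +ℤ + 2 ≡ lb
  lb-2+2≡lb = begin
    (lb -ℤ + 2) +ℤ + 2    ≡⟨ ℤₚ.+-assoc lb (- + 2) (+ 2) ⟩
    lb +ℤ (- + 2 +ℤ + 2)  ≡⟨ cong (lb +ℤ_) (ℤₚ.+-inverseˡ (+ 2)) ⟩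
    lb +ℤ + 0             ≡⟨ ℤₚ.+-identityʳ lb ⟩
    lb                    ∎
  ω+2≤lb : + (ω ℕ.+ 2) ≤ lb
  ω+2≤lb = subst (+ (ω ℕ.+ 2) ≤_) lb-2+2≡lb (ℤₚ.+-monoˡ-≤ (+ 2) ω≤lb-2)

module _ {n : ℕ} (G : Graph n) where

  clique? : ∀ C → Dec (IsClique G C)
  clique? C = Finₚ.all? λ v → Finₚ.all? λ w →
    (v ∈? C) →-dec ((w ∈? C) →-dec (¬? (v Finₚ.≟ w) →-dec adj? G v w))

  clique-⊆ : ∀ {C D} → D ⊆ C → IsClique G C → IsClique G D
  clique-⊆ D⊆C C-clique v w v∈ w∈ = C-clique v w (D⊆C v∈) (D⊆C w∈)

  cliqueNumber : ∀ W → ∃ (IsCliqueNumber G W)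
  cliqueNumber W with greatest-≤ cliqueOfSize? emptyClique n
    where
    CliqueOfSize : ℕ → Set
    CliqueOfSize c = ∃ λ C → C ⊆ W × IsClique G C × ∣ C ∣ ≡ c
    cliqueOfSize? : Decidable CliqueOfSize
    cliqueOfSize? c = anySubset? λ C → (C ⊆? W) ×-dec (clique? C ×-dec (∣ C ∣ ℕₚ.≟ c))
    emptyClique : CliqueOfSize 0
    emptyClique = ⊥ , ⊆-min W , (λ v w v∈ → contradiction v∈ ∉⊥) , ∣⊥∣≡0 n
  ... | c , clique , largest =
    c , clique , λ C C⊆W C-clique → largest (∣p∣≤n C) (C , C⊆W , C-clique , refl)

  cliqueNumber-mono : ∀ {W W′ c c′} → W ⊆ W′ →
                      IsCliqueNumber G W c → IsCliqueNumber G W′ c′ → c ℕ.≤ c′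
  cliqueNumber-mono W⊆W′ ((C , C⊆W , C-clique , refl) , _) (_ , largest′) =
    largest′ C (⊆-trans C⊆W W⊆W′) C-clique

  clique∋u≤1+ω : ∀ {u Nu ω C} → N G u Nu → IsCliqueNumber G Nu ω →
                 IsClique G C → u ∈ C → ∣ C ∣ ℕ.≤ ℕ.suc ω
  clique∋u≤1+ω {u} {Nu} {ω} {C} Nu-nbhd (_ , largest) C-clique u∈C =
    ℕₚ.≤-trans (∣p∣≤1+∣p-x∣ C u)
      (ℕ.s≤s (largest (C ∖ u) C-u⊆Nu (clique-⊆ (p─q⊆p C ⁅ u ⁆) C-clique)))
    where
    C-u⊆Nu : C ∖ u ⊆ Nu
    C-u⊆Nu {x} x∈ = let (_ , adj⇒∈) = Nu-nbhd x in
      adj⇒∈ (C-clique u x u∈C (p─q⊆p C ⁅ u ⁆ x∈) (λ u≡x → x∈p-y⇒x≢y C x∈ (≡-sym u≡x)))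

  cliqueNumber-remove : ∀ {u Nu ω W W′ c c′} → N G u Nu → IsCliqueNumber G Nu ω →
                        W ∖ u ⊆ W′ → IsCliqueNumber G W c → IsCliqueNumber G W′ c′ →
                        c ℕ.≤ c′ ⊎ c ℕ.≤ ℕ.suc ω
  cliqueNumber-remove {u} {W′ = W′} Nu-nbhd ωNu W-u⊆W′ ((C , C⊆W , C-clique , refl) , _) (_ , largest′)
    with u ∈? C
  ... | yes u∈C = inj₂ (clique∋u≤1+ω Nu-nbhd ωNu C-clique u∈C)
  ... | no  u∉C = inj₁ (largest′ C C⊆W′ C-clique)
    where
    C⊆W′ : C ⊆ W′
    C⊆W′ x∈C = W-u⊆W′ (x∈p∧x≢y⇒x∈p-y (C⊆W x∈C) λ { refl → u∉C x∈C })

  theta-mono : ∀ {W W′ k t t′} → W′ ⊆ W → IsTheta G W k t → IsTheta G W′ k t′ → t′ ℕ.≤ t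
  theta-mono {W′ = W′} W′⊆W ((S , _ , ∣S∣≤k , ωW-S) , _) (_ , smallest′)
    with cliqueNumber (W′ ─ (W′ ∩ S))
  ... | c , ωW′-S =
    ℕₚ.≤-trans (smallest′ (W′ ∩ S) c (p∩q⊆p W′ S) (ℕₚ.≤-trans (∣p∩q∣≤∣q∣ W′ S) ∣S∣≤k) ωW′-S)
               (cliqueNumber-mono (p─p∩q⊆r─q W′⊆W) ωW′-S ωW-S)

  theta-remove : ∀ {u Nu ω W k t t′} → N G u Nu → IsCliqueNumber G Nu ω →
                 IsTheta G W k t → IsTheta G (W ∖ u) k t′ → t ℕ.≤ t′ ⊎ t ℕ.≤ ℕ.suc ω
  theta-remove {u} {W = W} {t = t} Nu-nbhd ωNu (_ , smallest) ((S , S⊆W-u , ∣S∣≤k , ωW-u-S) , _)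
    with cliqueNumber (W ─ S)
  ... | c , ωW-S = map (ℕₚ.≤-trans t≤c) (ℕₚ.≤-trans t≤c)
        (cliqueNumber-remove Nu-nbhd ωNu (⊆-reflexive (p─q─r≡p─r─q W S ⁅ u ⁆)) ωW-S ωW-u-S)
    where
    t≤c : t ℕ.≤ c
    t≤c = smallest S c (⊆-trans S⊆W-u (p─q⊆p W ⁅ u ⁆)) ∣S∣≤k ωW-S

lemma1 : ∀ {n} (G : Graph n) (k : ℕ) (lb : ℤ) (u : Fin n) (t t' : ℕ) (Nu : Subset n) (ω : ℕ)
    → IsTheta G ⊤ k t → IsTheta G (⊤ ∖ u) k t'
    → lb ≤ + t
    → N G u Nu → IsCliqueNumber G Nu ω → + ω ≤ lb -ℤ + 2
    → t ≡ t'
lemma1 G k lb u t t' Nu ω θG θG-u lb≤t Nu-nbhd ωNu ω≤lb-2 =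
  ℕₚ.≤-antisym
    ([ id , (λ t≤1+ω → contradiction t≤1+ω (ℕₚ.<⇒≱ (1+ω<t ω≤lb-2 lb≤t))) ]′
       (theta-remove G Nu-nbhd ωNu θG θG-u))
    (theta-mono G (p─q⊆p ⊤ ⁅ u ⁆) θG θG-u)
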